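{- Over transitive frames, both of the following are valid for propositional variables $r,q$: - $⌢r,\,⌣⌢r\models q$, i.e. explosion for $⌣$ with $p$ replaced by $⌢r$; - $q\models ⌢⌣r,\,⌣r$, i.e. implosion for $⌢$ with $p$ replaced by $⌣r$.
   Context: Kripke semantics with local truth-preserving entailment; a multiple conclusion holds if some conclusion is true. The unary negative modalities are: - $w\Vdash ⌣\varphi$ iff $\varphi$ is false at some $R$-successor of $w$. - $w\Vdash ⌢\varphi$ iff $\varphi$ is false at every $R$-successor of $w$. A frame is transitive if $wRv$ and $vRu$ imply $wRu$. -}

module Defs where

open import Level using (Level; suc; _⊔_)
open import Data.Nat using (ℕ)
open import Data.List using (List; []; _∷_)
open import Data.List.Relation.Unary.All using (All)
open import Data.List.Relation.Unary.Any using (Any)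
open import Data.Product using (Σ; _×_)
open import Relation.Nullary using (¬_)

data Form : Set where
  var  : ℕ → Form
  ⌣_   : Form → Form
  ⌢_   : Form → Form

record Frame (a b : Level) : Set (suc (a ⊔ b)) where
  field
    W : Set a
    R : W → W → Set b

Transitive : ∀ {a b} → Frame a b → Set (a ⊔ b)
Transitive F = ∀ {w v u} → R w v → R v u → R w u
  where open Frame F

Valuation : ∀ {a b} → Frame a b → Set (suc a)
Valuation {a} F = ℕ → Frame.W F → Set a

_,_⊩_at_ : ∀ {a b} (F : Frame a b) → Valuation F → Form → Frame.W F → Set (a ⊔ b)
_,_⊩_at_ {a} {b} F V (var p) w = Level.Lift b (V p w)
F , V ⊩ (⌣ φ) at w = Σ (Frame.W F) λ v → Frame.R F w v × ¬ (F , V ⊩ φ at v)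
F , V ⊩ (⌢ φ) at w = ∀ v → Frame.R F w v → ¬ (F , V ⊩ φ at v)

infix 4 _⊨T_
_⊨T_ : List Form → List Form → Set₁
Γ ⊨T Δ = (F : Frame Level.zero Level.zero) → Transitive F →
         (V : Valuation F) → (w : Frame.W F) →
         All (λ φ → F , V ⊩ φ at w) Γ →
         ¬ All (λ ψ → ¬ (F , V ⊩ ψ at w)) Δ

{-# OPTIONS --safe #-}
module Submission where

open import Defs
open import Data.Nat using (ℕ)
open import Data.List using (List; []; _∷_)
open import Data.Product using (_×_; _,_)
open import Data.List.Relation.Unary.All using ([]; _∷_)
open import Relation.Nullary using (¬_)

-- In a transitive frame ⌢φ is inherited by every successor, so ⌢φ and ⌣⌢φ
-- can never hold together; dually, ⌣φ propagates back to every predecessor,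
-- so wherever ⌣φ fails, ⌢⌣φ holds.  Hence the premises of the explosion are
-- unsatisfiable and the conclusions of the implosion can never all fail,
-- whatever the other formulas are.

module _ {a b} {F : Frame a b} (trans : Transitive F) (V : Valuation F) where
  open Frame F

  ⌢-persistent : ∀ {φ w v} → R w v → F , V ⊩ ⌢ φ at w → F , V ⊩ ⌢ φ at v
  ⌢-persistent wRv ⌢φ u vRu = ⌢φ u (trans wRv vRu)

  ⌣-reflected : ∀ {φ w v} → R w v → F , V ⊩ ⌣ φ at v → F , V ⊩ ⌣ φ at w
  ⌣-reflected wRv (u , vRu , ¬φ) = u , trans wRv vRu , ¬φ

  ⌢⇒¬⌣⌢ : ∀ {φ w} → F , V ⊩ ⌢ φ at w → ¬ (F , V ⊩ ⌣ ⌢ φ at w)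
  ⌢⇒¬⌣⌢ ⌢φ (v , wRv , ¬⌢φ) = ¬⌢φ (⌢-persistent wRv ⌢φ)

  ¬⌣⇒⌢⌣ : ∀ {φ w} → ¬ (F , V ⊩ ⌣ φ at w) → F , V ⊩ ⌢ ⌣ φ at w
  ¬⌣⇒⌢⌣ ¬⌣φ v wRv ⌣φ = ¬⌣φ (⌣-reflected wRv ⌣φ)

⌢-⌣⌢-explosion : (φ : Form) (Δ : List Form) → ⌢ φ ∷ ⌣ ⌢ φ ∷ [] ⊨T Δ
⌢-⌣⌢-explosion φ Δ F trans V w (⌢φ ∷ ⌣⌢φ ∷ []) _ = ⌢⇒¬⌣⌢ trans V ⌢φ ⌣⌢φ

⌢⌣-⌣-implosion : (φ : Form) (Γ : List Form) → Γ ⊨T ⌢ ⌣ φ ∷ ⌣ φ ∷ []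
⌢⌣-⌣-implosion φ Γ F trans V w _ (¬⌢⌣φ ∷ ¬⌣φ ∷ []) = ¬⌢⌣φ (¬⌣⇒⌢⌣ trans V ¬⌣φ)

mainTheorem10 : (r q : ℕ) →
    ((⌢ var r) ∷ (⌣ (⌢ var r)) ∷ [] ⊨T (var q ∷ []))
    × ((var q ∷ []) ⊨T ((⌢ (⌣ var r)) ∷ (⌣ var r) ∷ []))
mainTheorem10 r q = ⌢-⌣⌢-explosion (var r) (var q ∷ []) , ⌢⌣-⌣-implosion (var r) (var q ∷ [])
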